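{- Suppose there exists a $(v,K,1)$-PBD. If for every $k\in K$ there exists a pair of disjoint $3$-MGDD$(g,k)$s, then there exists a pair of disjoint $3$-MGDD$(g,v)$s.
   Context: A $(v,K,1)$-PBD is a pair $(X,\mathcal B)$ with $|X|=v$ and $\mathcal B$ a set of subsets (blocks) of $X$ with sizes in $K$ such that every pair of distinct points lies in exactly one block. A $3$-MGDD$(g,t)$ (modified group divisible design) is a quadruple $(X,\mathcal G,\mathcal H,\mathcal A)$ where $X=\{x_{i,j}:0\le i\le t-1,\,0\le j\le g-1\}$ has $gt$ points, $\mathcal G$ consists of the $t$ groups $G_i=\{x_{i,0},\dots,x_{i,g-1}\}$, $\mathcal H$ consists of the $g$ holes $H_j=\{x_{0,j},\dots,x_{t-1,j}\}$, and $\mathcal A$ is a set of $3$-subsets (blocks) of $X$, each containing at most one point of any group and of any hole, such that every pair of points lying in distinct groups and distinct holes lies in exactly one block. Two $3$-MGDD$(g,t)$s with the same point set, groups and holes are disjoint if their block sets are disjoint. -}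

module Defs where

open import Level using (0ℓ)
open import Data.Nat using (ℕ)
open import Data.Fin using (Fin)
open import Data.Fin.Subset as S using (Subset; ∣_∣)
open import Data.Vec using (Vec; lookup)
open import Data.List using (List)
open import Data.List.Membership.Propositional using () renaming (_∈_ to _∈ₗ_; _∉_ to _∉ₗ_)
open import Data.List.Relation.Unary.Unique.Propositional using (Unique)
open import Data.Product using (Σ; _×_; _,_; proj₁; proj₂; ∃-syntax)
open import Relation.Binary.PropositionalEquality using (_≡_; _≢_)

ExactlyOne : {A : Set} → List A → (A → Set) → Set
ExactlyOne {A} B P =
  Σ A (λ b → b ∈ₗ B × P b) ×
  (∀ b b' → b ∈ₗ B → b' ∈ₗ B → P b → P b' → b ≡ b')

-- Pairwise balanced designs.  Point set X = Fin v, block set a finite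
-- set (duplicate-free list) of subsets of X, K a set of sizes (predicate).

record PBD (v : ℕ) (K : ℕ → Set) : Set where
  field
    blocks   : List (Subset v)
    distinct : Unique blocks
    sizes    : ∀ b → b ∈ₗ blocks → K ∣ b ∣
    pairs    : ∀ (x y : Fin v) → x ≢ y →
               ExactlyOne blocks (λ b → x S.∈ b × y S.∈ b)

-- Point x_{i,j} is (i , j) : Fin t × Fin g; group G_i is
-- the set of points with first coordinate i, hole H_j those with second
-- coordinate j.  A subset of the points is a row vector of subsets:
-- row i is { j | x_{i,j} ∈ block }.

Point : ℕ → ℕ → Set
Point g t = Fin t × Fin g

group : ∀ {g t} → Point g t → Fin t
group = proj₁

hole : ∀ {g t} → Point g t → Fin g
hole = proj₂

PSet : ℕ → ℕ → Set
PSet g t = Vec (Subset g) t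

_∈ᵖ_ : ∀ {g t} → Point g t → PSet g t → Set
(i , j) ∈ᵖ b = j S.∈ lookup b i

card : ∀ {g t} → PSet g t → ℕ
card {t = t} b = Data.Vec.sum (Data.Vec.map ∣_∣ b)
  where import Data.Vec

IsMGDDBlock : ∀ {g t} → PSet g t → Set
IsMGDDBlock {g} {t} b =
  card b ≡ 3 ×
  (∀ (p q : Point g t) → p ∈ᵖ b → q ∈ᵖ b → group p ≡ group q → p ≡ q) ×
  (∀ (p q : Point g t) → p ∈ᵖ b → q ∈ᵖ b → hole p ≡ hole q → p ≡ q)

record MGDD3 (g t : ℕ) : Set where
  field
    blocks   : List (PSet g t)
    distinct : Unique blocks
    isBlock  : ∀ b → b ∈ₗ blocks → IsMGDDBlock b
    pairs    : ∀ (p q : Point g t) → group p ≢ group q → hole p ≢ hole q →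
               ExactlyOne blocks (λ b → p ∈ᵖ b × q ∈ᵖ b)

Disjoint : ∀ {g t} → MGDD3 g t → MGDD3 g t → Set
Disjoint D E = ∀ b → b ∈ₗ MGDD3.blocks D → b ∉ₗ MGDD3.blocks E

DisjointPair : ℕ → ℕ → Set
DisjointPair g t = ∃[ D ] ∃[ E ] Disjoint {g} {t} D E

-- Fill the blocks of the PBD: a block b of size k spans k of the v groups,
-- and a 3-MGDD(g,k) placed on those groups (with all g holes) covers exactly
-- the pairs whose groups both lie in b.  Every pair of points in distinct
-- groups and holes has its two groups in exactly one block b of the PBD, and
-- then lies in exactly one block of the design placed on b.  Since any block
-- meets two groups, it remembers the PBD block it was placed on; hence
-- filling with the first, resp. second, design of each disjoint pair gives
-- two disjoint designs.
module Submission where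

open import Defs
open import Data.Nat using (ℕ; zero; suc; pred; _+_; _≤_; z≤n; s≤s)
open import Data.Fin using (Fin; zero; suc)
open import Data.Fin.Properties using (suc-injective)
open import Data.Fin.Subset as S using (Subset; ∣_∣; inside; outside; ⊥)
open import Data.Fin.Subset.Properties using (∉⊥; ∣⊥∣≡0)
open import Data.Bool.Properties using () renaming (_≟_ to _≟ᵇ_)
open import Data.Vec using ([]; _∷_; here; there)
open import Data.Vec.Properties using (≡-dec; ∷-injectiveˡ; ∷-injectiveʳ)
open import Data.List using (List; map; concat; deduplicate)
open import Data.List.Membership.Propositional using (_∈_; mapWith∈)
open import Data.List.Membership.Propositional.Properties
  using (∈-map⁺; ∈-map⁻; ∈-concat⁺; ∈-concat⁻; ∈-deduplicate⁺; ∈-deduplicate⁻)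
open import Data.List.Membership.Propositional.Properties.WithK using (unique⇒irrelevant)
open import Data.List.Relation.Unary.Any.Properties using (mapWith∈⁺; mapWith∈⁻)
open import Data.List.Relation.Unary.Unique.DecPropositional.Properties using (deduplicate-!)
open import Data.Product using (Σ; _×_; _,_; proj₁; proj₂; map₁)
open import Data.Empty using (⊥-elim)
open import Relation.Binary.PropositionalEquality

enumerate : ∀ {n} (b : Subset n) → Fin ∣ b ∣ → Fin n
enumerate (inside  ∷ b) zero    = zero
enumerate (inside  ∷ b) (suc j) = suc (enumerate b j)
enumerate (outside ∷ b) j       = suc (enumerate b j)

enumerate-injective : ∀ {n} (b : Subset n) {j j'} → enumerate b j ≡ enumerate b j' → j ≡ j'
enumerate-injective (inside  ∷ b) {zero}  {zero}   _ = refl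
enumerate-injective (inside  ∷ b) {suc j} {suc j'} e = cong suc (enumerate-injective b (suc-injective e))
enumerate-injective (outside ∷ b)                  e = enumerate-injective b (suc-injective e)

enumerate-∈ : ∀ {n} (b : Subset n) j → enumerate b j S.∈ b
enumerate-∈ (inside  ∷ b) zero    = here
enumerate-∈ (inside  ∷ b) (suc j) = there (enumerate-∈ b j)
enumerate-∈ (outside ∷ b) j       = there (enumerate-∈ b j)

enumerate-surjective : ∀ {n} (b : Subset n) {i} → i S.∈ b → Σ (Fin ∣ b ∣) λ j → enumerate b j ≡ i
enumerate-surjective (inside  ∷ b) here      = zero , refl
enumerate-surjective (inside  ∷ b) (there m) = let j , e = enumerate-surjective b m in suc j , cong suc e
enumerate-surjective (outside ∷ b) (there m) = let j , e = enumerate-surjective b m in j , cong suc e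

∣p∣≡1+k⇒Nonempty : ∀ {n k} (p : Subset n) → ∣ p ∣ ≡ suc k → S.Nonempty p
∣p∣≡1+k⇒Nonempty (inside  ∷ p) _ = zero , here
∣p∣≡1+k⇒Nonempty (outside ∷ p) e = let x , x∈ = ∣p∣≡1+k⇒Nonempty p e in suc x , there x∈

∣p∣≡2+k⇒distinct-∈ : ∀ {n k} (p : Subset n) → ∣ p ∣ ≡ suc (suc k) →
                     Σ (Fin n) λ x → Σ (Fin n) λ y → x S.∈ p × y S.∈ p × x ≢ y
∣p∣≡2+k⇒distinct-∈ (inside ∷ p) e =
  let y , y∈ = ∣p∣≡1+k⇒Nonempty p (cong pred e) in zero , suc y , here , there y∈ , λ ()
∣p∣≡2+k⇒distinct-∈ (outside ∷ p) e =
  let x , y , x∈ , y∈ , x≢y = ∣p∣≡2+k⇒distinct-∈ p e in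
  suc x , suc y , there x∈ , there y∈ , λ sx≡sy → x≢y (suc-injective sx≡sy)

∈ᵖ-of-card≥1 : ∀ {g t} (c : PSet g t) → 1 ≤ card c → Σ (Point g t) (_∈ᵖ c)
∈ᵖ-of-card≥1 (r ∷ c) 1≤ with ∣ r ∣ in eq
... | zero  = let (i , h) , p∈ = ∈ᵖ-of-card≥1 c 1≤ in (suc i , h) , p∈
... | suc _ = let h , h∈ = ∣p∣≡1+k⇒Nonempty r eq in (zero , h) , h∈

distinct-∈ᵖ-of-card≥2 : ∀ {g t} (c : PSet g t) → 2 ≤ card c →
  Σ (Point g t) λ p → Σ (Point g t) λ q → p ∈ᵖ c × q ∈ᵖ c × p ≢ q
distinct-∈ᵖ-of-card≥2 (r ∷ c) 2≤ with ∣ r ∣ in eq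
distinct-∈ᵖ-of-card≥2 (r ∷ c) 2≤ | zero with distinct-∈ᵖ-of-card≥2 c 2≤
... | (i , h) , (i' , h') , p∈ , q∈ , p≢q = (suc i , h) , (suc i' , h') , p∈ , q∈ , λ { refl → p≢q refl }
distinct-∈ᵖ-of-card≥2 (r ∷ c) (s≤s 1≤) | suc zero =
  let h , h∈ = ∣p∣≡1+k⇒Nonempty r eq
      (i , h') , q∈ = ∈ᵖ-of-card≥1 c 1≤
  in (zero , h) , (suc i , h') , h∈ , q∈ , λ ()
distinct-∈ᵖ-of-card≥2 (r ∷ c) 2≤ | suc (suc _) with ∣p∣≡2+k⇒distinct-∈ r eq
... | h , h' , h∈ , h'∈ , h≢h' = (zero , h) , (zero , h') , h∈ , h'∈ , λ { refl → h≢h' refl }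

block-meets-two-groups : ∀ {g t} (c : PSet g t) → IsMGDDBlock c →
  Σ (Point g t) λ p → Σ (Point g t) λ q → p ∈ᵖ c × q ∈ᵖ c × group p ≢ group q
block-meets-two-groups c (card≡3 , sameGroup , _)
  with distinct-∈ᵖ-of-card≥2 c (subst (2 ≤_) (sym card≡3) (s≤s (s≤s z≤n)))
... | p , q , p∈ , q∈ , p≢q = p , q , p∈ , q∈ , λ e → p≢q (sameGroup p q p∈ q∈ e)

embedPoint : ∀ {g n} (b : Subset n) → Point g ∣ b ∣ → Point g n
embedPoint b = map₁ (enumerate b)

embed : ∀ {g n} (b : Subset n) → PSet g ∣ b ∣ → PSet g n
embed []            []      = []
embed (inside  ∷ b) (r ∷ c) = r ∷ embed b c
embed (outside ∷ b) c       = ⊥ ∷ embed b c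

card-embed : ∀ {g n} (b : Subset n) (c : PSet g ∣ b ∣) → card (embed b c) ≡ card c
card-embed []            []      = refl
card-embed (inside  ∷ b) (r ∷ c) = cong (∣ r ∣ +_) (card-embed b c)
card-embed {g} (outside ∷ b) c   = trans (cong (_+ card (embed b c)) (∣⊥∣≡0 g)) (card-embed b c)

embed-injective : ∀ {g n} (b : Subset n) {c c' : PSet g ∣ b ∣} → embed b c ≡ embed b c' → c ≡ c'
embed-injective []            {[]}    {[]}      refl = refl
embed-injective (inside  ∷ b) {r ∷ c} {r' ∷ c'} e    =
  cong₂ _∷_ (∷-injectiveˡ e) (embed-injective b (∷-injectiveʳ e))
embed-injective (outside ∷ b)                   e    = embed-injective b (∷-injectiveʳ e)

∈ᵖ-embed⁺ : ∀ {g n} (b : Subset n) (c : PSet g ∣ b ∣) {p} → p ∈ᵖ c → embedPoint b p ∈ᵖ embed b c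
∈ᵖ-embed⁺ (inside  ∷ b) (r ∷ c) {zero  , _} p∈ = p∈
∈ᵖ-embed⁺ (inside  ∷ b) (r ∷ c) {suc _ , _} p∈ = ∈ᵖ-embed⁺ b c p∈
∈ᵖ-embed⁺ (outside ∷ b) c                   p∈ = ∈ᵖ-embed⁺ b c p∈

∈ᵖ-embed⁻ : ∀ {g n} (b : Subset n) (c : PSet g ∣ b ∣) {i h} → (i , h) ∈ᵖ embed b c →
            Σ (Fin ∣ b ∣) λ j → (j , h) ∈ᵖ c × enumerate b j ≡ i
∈ᵖ-embed⁻ (inside  ∷ b) (r ∷ c) {zero}  p∈ = zero , p∈ , refl
∈ᵖ-embed⁻ (inside  ∷ b) (r ∷ c) {suc i} p∈ = let j , q∈ , e = ∈ᵖ-embed⁻ b c p∈ in suc j , q∈ , cong suc e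
∈ᵖ-embed⁻ (outside ∷ b) c       {zero}  p∈ = ⊥-elim (∉⊥ p∈)
∈ᵖ-embed⁻ (outside ∷ b) c       {suc i} p∈ = let j , q∈ , e = ∈ᵖ-embed⁻ b c p∈ in j , q∈ , cong suc e

∈ᵖ-embed-enumerate⁻ : ∀ {g n} (b : Subset n) (c : PSet g ∣ b ∣) {p} → embedPoint b p ∈ᵖ embed b c → p ∈ᵖ c
∈ᵖ-embed-enumerate⁻ b c p∈ with ∈ᵖ-embed⁻ b c p∈
... | j , q∈ , e with enumerate-injective b e
... | refl = q∈

∈ᵖ-embed⇒group∈ : ∀ {g n} (b : Subset n) (c : PSet g ∣ b ∣) {p} → p ∈ᵖ embed b c → group p S.∈ b
∈ᵖ-embed⇒group∈ b c p∈ with ∈ᵖ-embed⁻ b c p∈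
... | j , _ , refl = enumerate-∈ b j

embed-isBlock : ∀ {g n} (b : Subset n) (c : PSet g ∣ b ∣) → IsMGDDBlock c → IsMGDDBlock (embed b c)
embed-isBlock {g} {n} b c (card≡3 , sameGroup , sameHole) =
  trans (card-embed b c) card≡3 , sameGroup′ , sameHole′
  where
  sameGroup′ : ∀ (p q : Point g n) → p ∈ᵖ embed b c → q ∈ᵖ embed b c → group p ≡ group q → p ≡ q
  sameGroup′ (_ , h) (_ , h') p∈ q∈ e with ∈ᵖ-embed⁻ b c p∈ | ∈ᵖ-embed⁻ b c q∈
  ... | j , p′∈ , refl | j' , q′∈ , refl =
    cong (embedPoint b) (sameGroup (j , h) (j' , h') p′∈ q′∈ (enumerate-injective b e))
  sameHole′ : ∀ (p q : Point g n) → p ∈ᵖ embed b c → q ∈ᵖ embed b c → hole p ≡ hole q → p ≡ q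
  sameHole′ (_ , h) (_ , h') p∈ q∈ e with ∈ᵖ-embed⁻ b c p∈ | ∈ᵖ-embed⁻ b c q∈
  ... | j , p′∈ , refl | j' , q′∈ , refl =
    cong (embedPoint b) (sameHole (j , h) (j' , h') p′∈ q′∈ e)

module Filling {v g : ℕ} {K : ℕ → Set} (P : PBD v K)
               (design : ∀ b → b ∈ PBD.blocks P → MGDD3 g ∣ b ∣) where

  open PBD P using () renaming (blocks to lines)

  block-unique : ∀ {i i' b b'} → i ≢ i' → b ∈ lines → b' ∈ lines →
                 i S.∈ b → i' S.∈ b → i S.∈ b' → i' S.∈ b' → b ≡ b'
  block-unique {i} {i'} {b} {b'} i≢i' b∈ b'∈ i∈b i'∈b i∈b' i'∈b' =
    proj₂ (PBD.pairs P i i' i≢i') b b' b∈ b'∈ (i∈b , i'∈b) (i∈b' , i'∈b')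

  filling : List (PSet g v)
  filling = concat (mapWith∈ lines λ {b} b∈ → map (embed b) (MGDD3.blocks (design b b∈)))

  ∈-filling⁺ : ∀ {b} (b∈ : b ∈ lines) {c} → c ∈ MGDD3.blocks (design b b∈) → embed b c ∈ filling
  ∈-filling⁺ {b} b∈ c∈ = ∈-concat⁺ (mapWith∈⁺ _ (b , b∈ , ∈-map⁺ (embed b) c∈))

  ∈-filling⁻ : ∀ {x} → x ∈ filling →
    Σ (Subset v) λ b → Σ (b ∈ lines) λ b∈ → Σ (PSet g ∣ b ∣) λ c →
    c ∈ MGDD3.blocks (design b b∈) × x ≡ embed b c
  ∈-filling⁻ x∈ with mapWith∈⁻ lines _ (∈-concat⁻ _ x∈)
  ... | b , b∈ , x∈b with ∈-map⁻ (embed b) x∈b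
  ... | c , c∈ , e = b , b∈ , c , c∈ , e

  ∈-filling-at : ∀ {x} → x ∈ filling → ∀ {p q} → p ∈ᵖ x → q ∈ᵖ x → group p ≢ group q →
    ∀ {b} (b∈ : b ∈ lines) → group p S.∈ b → group q S.∈ b →
    Σ (PSet g ∣ b ∣) λ c → c ∈ MGDD3.blocks (design b b∈) × x ≡ embed b c
  ∈-filling-at x∈ p∈ q∈ p≁q b∈ p∈b q∈b with ∈-filling⁻ x∈
  ... | b₀ , b₀∈ , c , c∈ , refl
    with block-unique p≁q b₀∈ b∈ (∈ᵖ-embed⇒group∈ b₀ c p∈) (∈ᵖ-embed⇒group∈ b₀ c q∈) p∈b q∈b
  ... | refl with unique⇒irrelevant (PBD.distinct P) b₀∈ b∈
  ... | refl = c , c∈ , refl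

  -- The filling has no repeated blocks anyway; deduplicating spares that proof.
  blocks : List (PSet g v)
  blocks = deduplicate (≡-dec (≡-dec _≟ᵇ_)) filling

  ∈-blocks⇒∈-filling : ∀ {x} → x ∈ blocks → x ∈ filling
  ∈-blocks⇒∈-filling = ∈-deduplicate⁻ _ filling

  isBlock : ∀ x → x ∈ blocks → IsMGDDBlock x
  isBlock x x∈ with ∈-filling⁻ (∈-blocks⇒∈-filling x∈)
  ... | b , b∈ , c , c∈ , refl = embed-isBlock b c (MGDD3.isBlock (design b b∈) c c∈)

  pairs : ∀ (p q : Point g v) → group p ≢ group q → hole p ≢ hole q →
          ExactlyOne blocks (λ x → p ∈ᵖ x × q ∈ᵖ x)
  pairs (i , h) (i' , h') i≢i' h≢h' with PBD.pairs P i i' i≢i'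
  ... | (b , b∈ , i∈b , i'∈b) , _ with enumerate-surjective b i∈b | enumerate-surjective b i'∈b
  ... | j , refl | j' , refl with MGDD3.pairs (design b b∈) (j , h) (j' , h') (λ { refl → i≢i' refl }) h≢h'
  ... | (c , c∈ , p∈ , q∈) , c-unique =
    (embed b c , ∈-deduplicate⁺ _ (∈-filling⁺ b∈ c∈) , ∈ᵖ-embed⁺ b c p∈ , ∈ᵖ-embed⁺ b c q∈) ,
    λ x y x∈ y∈ x∋ y∋ → trans (is-embed-c x∈ x∋) (sym (is-embed-c y∈ y∋))
    where
    is-embed-c : ∀ {x} → x ∈ blocks → (enumerate b j , h) ∈ᵖ x × (enumerate b j' , h') ∈ᵖ x → x ≡ embed b c
    is-embed-c x∈ (p∈x , q∈x) with ∈-filling-at (∈-blocks⇒∈-filling x∈) p∈x q∈x i≢i' b∈ i∈b i'∈b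
    ... | c' , c'∈ , refl =
      cong (embed b) (c-unique c' c c'∈ c∈
        (∈ᵖ-embed-enumerate⁻ b c' p∈x , ∈ᵖ-embed-enumerate⁻ b c' q∈x) (p∈ , q∈))

  mgdd : MGDD3 g v
  mgdd = record { blocks = blocks ; distinct = deduplicate-! _ filling ; isBlock = isBlock ; pairs = pairs }

filling-disjoint : ∀ {v g K} (P : PBD v K) (D E : ∀ b → b ∈ PBD.blocks P → MGDD3 g ∣ b ∣) →
  (∀ b b∈ → Disjoint (D b b∈) (E b b∈)) → Disjoint (Filling.mgdd P D) (Filling.mgdd P E)
filling-disjoint P D E D∩E≡∅ x x∈D x∈E
  with block-meets-two-groups x (Filling.isBlock P D x x∈D)
... | p , q , p∈ , q∈ , p≁q with Filling.∈-filling⁻ P D (Filling.∈-blocks⇒∈-filling P D x∈D)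
... | b , b∈ , c , c∈D , refl
  with Filling.∈-filling-at P E (Filling.∈-blocks⇒∈-filling P E x∈E) p∈ q∈ p≁q b∈
         (∈ᵖ-embed⇒group∈ b c p∈) (∈ᵖ-embed⇒group∈ b c q∈)
... | c' , c'∈E , e with embed-injective b e
... | refl = D∩E≡∅ b b∈ c c∈D c'∈E

lemma8p1 : (v g : ℕ) (K : ℕ → Set) →
    PBD v K →
    (∀ k → K k → DisjointPair g k) →
    DisjointPair g v
lemma8p1 v g K P disjointPair =
  Filling.mgdd P first , Filling.mgdd P second , filling-disjoint P first second disjoint
  where
  pairOn : ∀ b → b ∈ PBD.blocks P → DisjointPair g ∣ b ∣
  pairOn b b∈ = disjointPair ∣ b ∣ (PBD.sizes P b b∈)
  first second : ∀ b → b ∈ PBD.blocks P → MGDD3 g ∣ b ∣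
  first  b b∈ = proj₁ (pairOn b b∈)
  second b b∈ = proj₁ (proj₂ (pairOn b b∈))
  disjoint : ∀ b b∈ → Disjoint (first b b∈) (second b b∈)
  disjoint b b∈ = proj₂ (proj₂ (pairOn b b∈))
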